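{- Let $m\ge2$ and let $s$ be an integer with $1<s<m$ and $\gcd(s,m)=1$. Then \[ E(m,s)\le \frac{s}{\ln s}\ln(m)+s-1 . \]
   Context: An expression is a formal term built from the symbol $x$ using the binary operations $+$ and $\cdot$ (with parentheses); its size is the number of occurrences of $x$ in it. For $m\ge2$ and a unit $s\in\mathbb{Z}/m\mathbb{Z}$ (the base), the complexity $||a||_s$ of $a\in\mathbb{Z}/m\mathbb{Z}$ is the minimum size of an expression that evaluates to $a$ in $\mathbb{Z}/m\mathbb{Z}$ when $x=s$ (every element of $\mathbb{Z}/m\mathbb{Z}$ is the value of some expression when $s$ is a unit). The inefficiency of $s$ is $E(m,s)=\max_{a\in\mathbb{Z}/m\mathbb{Z}}||a||_s$. The integer $s$ is identified with its residue class mod $m$. -}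

module Defs where

open import Data.Nat using (ℕ; zero; suc; _+_; _*_; _<_; _≤_; NonZero)
open import Data.Nat.DivMod using (_%_)
open import Data.Product using (Σ; _×_; ∃-syntax)
open import Relation.Binary.PropositionalEquality using (_≡_)

data Expr : Set where
  x   : Expr
  _⊕_ : Expr → Expr → Expr
  _⊗_ : Expr → Expr → Expr

size : Expr → ℕ
size x       = 1
size (e ⊕ f) = size e + size f
size (e ⊗ f) = size e + size f

eval : ℕ → Expr → ℕ
eval s x       = s
eval s (e ⊕ f) = eval s e + eval s f
eval s (e ⊗ f) = eval s e * eval s f

-- e evaluates to (the residue class of) a in ℤ/mℤ when x = s
-- (evaluation in ℤ/mℤ is the reduction mod m of the evaluation in ℕ)
EvalsTo : (m : ℕ) .{{_ : NonZero m}} → ℕ → Expr → ℕ → Set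
EvalsTo m s e a = eval s e % m ≡ a % m

IsComplexity : (m : ℕ) .{{_ : NonZero m}} → (s a c : ℕ) → Set
IsComplexity m s a c =
  (∃[ e ] (size e ≡ c × EvalsTo m s e a)) ×
  ((e : Expr) → EvalsTo m s e a → c ≤ size e)

-- E = E(m,s) = max over a ∈ ℤ/mℤ (represented by 0 ≤ a < m) of ||a||_s
IsInefficiency : (m : ℕ) .{{_ : NonZero m}} → (s E : ℕ) → Set
IsInefficiency m s E =
  ((a : ℕ) → a < m → ∃[ c ] (IsComplexity m s a c × c ≤ E)) ×
  (∃[ a ] (a < m × IsComplexity m s a E))

{-# OPTIONS --safe #-}
module Submission where

-- Since s is invertible mod m, every residue a is s q mod m for some 1 ≤ q ≤ m. Writing q
-- in base s with L + 1 digits (so s ^ L ≤ q) and evaluating s q by Horner's scheme gives an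
-- expression of size at most (L + 1) s - 1. Hence E + 1 - s ≤ L s, and
-- s ^ (E + 1 - s) ≤ (s ^ L) ^ s ≤ m ^ s, which is the claim after taking logarithms.

open import Defs
open import Data.Nat using (ℕ; zero; suc; _+_; _*_; _∸_; _^_; _<_; _≤_; _/_; _%_; _<?_; NonZero; >-nonZero⁻¹; z≤n; s≤s; z<s)
open import Data.Nat.Coprimality using (gcd≡1⇒coprime; coprime-Bézout)
open import Data.Nat.DivMod
open import Data.Nat.GCD using (gcd; module Bézout)
open import Data.Nat.Induction using (<-wellFounded)
open import Data.Nat.Properties
open import Data.Nat.Tactic.RingSolver using (solve-∀)
open import Data.Product using (_×_; _,_; ∃-syntax)
open import Induction.WellFounded using (Acc; acc)
open import Relation.Binary.PropositionalEquality using (_≡_; refl; sym; trans; cong; cong₂; subst; module ≡-Reasoning)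
open import Relation.Nullary using (yes; no)

_⊕xs_ : Expr → ℕ → Expr
e ⊕xs zero  = e
e ⊕xs suc r = (e ⊕xs r) ⊕ x

eval-⊕xs : ∀ s e r → eval s (e ⊕xs r) ≡ eval s e + r * s
eval-⊕xs s e zero    = sym (+-identityʳ (eval s e))
eval-⊕xs s e (suc r) = begin
  eval s (e ⊕xs r) + s   ≡⟨ cong (_+ s) (eval-⊕xs s e r) ⟩
  eval s e + r * s + s   ≡⟨ +-assoc (eval s e) (r * s) s ⟩
  eval s e + (r * s + s) ≡⟨ cong (eval s e +_) (+-comm (r * s) s) ⟩
  eval s e + suc r * s   ∎
  where open ≡-Reasoning

size-⊕xs : ∀ e r → size (e ⊕xs r) ≡ size e + r
size-⊕xs e zero    = sym (+-identityʳ (size e))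
size-⊕xs e (suc r) = begin
  size (e ⊕xs r) + 1 ≡⟨ cong (_+ 1) (size-⊕xs e r) ⟩
  size e + r + 1     ≡⟨ +-comm (size e + r) 1 ⟩
  suc (size e + r)   ≡⟨ sym (+-suc (size e) r) ⟩
  size e + suc r     ∎
  where open ≡-Reasoning

-- Horner's scheme in base s: with q = r + q′ s (r < s), s q = x · (s q′) + x + ⋯ + x (r times).
horner-expr : ∀ {s} → 1 < s → ∀ q → Acc _<_ q → 0 < q →
  ∃[ e ] ∃[ L ] (eval s e ≡ s * q × size e < suc L * s × s ^ L ≤ q)
horner-expr {s@(suc _)} 1<s q@(suc k) _ _ with q <? s
... | yes q<s = x ⊕xs k , 0 , eval≡ , size< , s≤s z≤n
  where
  eval≡ : eval s (x ⊕xs k) ≡ s * q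
  eval≡ = trans (eval-⊕xs s x k) (*-comm q s)
  size< : size (x ⊕xs k) < 1 * s
  size< rewrite size-⊕xs x k | *-identityˡ s = q<s
horner-expr {s@(suc _)} 1<s q@(suc _) (acc rec) _ | no q≮s
  with horner-expr 1<s (q / s) (rec (m/n<m q s 1<s)) (m≥n⇒m/n>0 (≮⇒≥ q≮s))
... | e , L , ev , sz , pw = (x ⊗ e) ⊕xs (q % s) , suc L , eval≡ , size< , power≤
  where
  open ≡-Reasoning
  q′ r : ℕ
  q′ = q / s
  r = q % s
  regroup : ∀ a b c → a * (a * b) + c * a ≡ a * (c + b * a)
  regroup = solve-∀
  eval≡ : eval s ((x ⊗ e) ⊕xs r) ≡ s * q
  eval≡ = begin
    eval s ((x ⊗ e) ⊕xs r) ≡⟨ eval-⊕xs s (x ⊗ e) r ⟩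
    s * eval s e + r * s   ≡⟨ cong (λ v → s * v + r * s) ev ⟩
    s * (s * q′) + r * s   ≡⟨ regroup s q′ r ⟩
    s * (r + q′ * s)       ≡⟨ cong (s *_) (sym (m≡m%n+[m/n]*n q s)) ⟩
    s * q                  ∎
  size< : size ((x ⊗ e) ⊕xs r) < suc (suc L) * s
  size< rewrite size-⊕xs (x ⊗ e) r | +-comm s (suc L * s) =
    +-mono-≤-< sz (m%n<n q s)
  power≤ : s ^ suc L ≤ q
  power≤ = ≤-trans (*-monoʳ-≤ s pw) (≤-trans (≤-reflexive (*-comm s q′)) (m/n*n≤m q s))

multiple-expr : ∀ {s q} → 1 < s → 0 < q →
  ∃[ e ] (eval s e ≡ s * q × s ^ (size e + 1 ∸ s) ≤ q ^ s)
multiple-expr {s@(suc _)} {q} 1<s 0<q with horner-expr 1<s q (<-wellFounded q) 0<q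
... | e , L , ev , sz , pw = e , ev , (begin
  s ^ (size e + 1 ∸ s) ≤⟨ ^-monoʳ-≤ s (m≤n+o⇒m∸n≤o (size e + 1) s size+1≤) ⟩
  s ^ (L * s)          ≡⟨ sym (^-*-assoc s L s) ⟩
  (s ^ L) ^ s          ≤⟨ ^-monoˡ-≤ s pw ⟩
  q ^ s                ∎)
  where
  open ≤-Reasoning
  size+1≤ : size e + 1 ≤ suc L * s
  size+1≤ = ≤-trans (≤-reflexive (+-comm (size e) 1)) sz

%-*-cong : ∀ m .{{_ : NonZero m}} {a a′ b b′} →
  a % m ≡ a′ % m → b % m ≡ b′ % m → (a * b) % m ≡ (a′ * b′) % m
%-*-cong m {a} {a′} {b} {b′} a≡a′ b≡b′ = begin
  (a * b) % m                 ≡⟨ %-distribˡ-* a b m ⟩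
  ((a % m) * (b % m)) % m     ≡⟨ cong₂ (λ u v → (u * v) % m) a≡a′ b≡b′ ⟩
  ((a′ % m) * (b′ % m)) % m   ≡⟨ sym (%-distribˡ-* a′ b′ m) ⟩
  (a′ * b′) % m               ∎
  where open ≡-Reasoning

coprime⇒inverse : ∀ s m .{{_ : NonZero m}} → gcd s m ≡ 1 → ∃[ u ] ((s * u) % m ≡ 1 % m)
coprime⇒inverse s m@(suc m′) g with coprime-Bézout (gcd≡1⇒coprime g)
... | Bézout.+- u y eq = u , (begin
  (s * u) % m     ≡⟨ cong (_% m) (trans (*-comm s u) (sym eq)) ⟩
  (1 + y * m) % m ≡⟨ [m+kn]%n≡m%n 1 y m ⟩
  1 % m           ∎)
  where open ≡-Reasoning
-- Here s v ≡ -1 (mod m), so v (m - 1) inverts s.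
... | Bézout.-+ v y eq = v * m′ , (begin
  (s * (v * m′)) % m          ≡⟨ sym ([m+kn]%n≡m%n (s * (v * m′)) 1 m) ⟩
  (s * (v * m′) + 1 * m) % m  ≡⟨ cong (_% m) (expand s v m′) ⟩
  ((1 + v * s) * m′ + 1) % m  ≡⟨ cong (λ t → (t * m′ + 1) % m) eq ⟩
  (y * m * m′ + 1) % m        ≡⟨ cong (_% m) (regroup y m′) ⟩
  (1 + y * m′ * m) % m        ≡⟨ [m+kn]%n≡m%n 1 (y * m′) m ⟩
  1 % m                       ∎)
  where
  open ≡-Reasoning
  expand : ∀ a b c → a * (b * c) + 1 * suc c ≡ (1 + b * a) * c + 1
  expand = solve-∀
  regroup : ∀ a c → a * suc c * c + 1 ≡ 1 + a * c * suc c
  regroup = solve-∀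

positive-representative : ∀ m .{{_ : NonZero m}} n → ∃[ q ] (0 < q × q ≤ m × q % m ≡ n % m)
positive-representative m n with n % m in eq
... | zero  = m , >-nonZero⁻¹ m , ≤-refl , n%n≡0 m
... | suc t = suc t , z<s , subst (_≤ m) eq (m%n≤n n m) , subst (λ v → v % m ≡ v) eq (m%n%n≡m%n n m)

coprime⇒linear-congruence-solvable : ∀ s m .{{_ : NonZero m}} → gcd s m ≡ 1 →
  ∀ a → ∃[ q ] (0 < q × q ≤ m × (s * q) % m ≡ a % m)
coprime⇒linear-congruence-solvable s m g a with coprime⇒inverse s m g
... | u , su≡1 with positive-representative m (u * a)
... | q , 0<q , q≤m , q≡ua = q , 0<q , q≤m , (begin
  (s * q) % m       ≡⟨ %-*-cong m {a = s} refl q≡ua ⟩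
  (s * (u * a)) % m ≡⟨ cong (_% m) (sym (*-assoc s u a)) ⟩
  (s * u * a) % m   ≡⟨ %-*-cong m {b = a} su≡1 refl ⟩
  (1 * a) % m       ≡⟨ cong (_% m) (*-identityˡ a) ⟩
  a % m             ∎)
  where open ≡-Reasoning

theorem4p6 : (m s : ℕ) .{{_ : NonZero m}} → 1 < s → s < m → gcd s m ≡ 1 →
    (E : ℕ) → IsInefficiency m s E →
    s ^ (E + 1 ∸ s) ≤ m ^ s
theorem4p6 m s@(suc _) 1<s _ g E (_ , a , _ , _ , minimal)
  with coprime⇒linear-congruence-solvable s m g a
... | q , 0<q , q≤m , sq≡a with multiple-expr 1<s 0<q
... | e , ev , bound = begin
  s ^ (E + 1 ∸ s)      ≤⟨ ^-monoʳ-≤ s (∸-monoˡ-≤ s (+-monoˡ-≤ 1 E≤size)) ⟩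
  s ^ (size e + 1 ∸ s) ≤⟨ bound ⟩
  q ^ s                ≤⟨ ^-monoˡ-≤ s q≤m ⟩
  m ^ s                ∎
  where
  open ≤-Reasoning
  E≤size : E ≤ size e
  E≤size = minimal e (trans (cong (_% m) ev) sq≡a)
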